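{- Let $\mathcal{R}$ be an LCTRS. If a constrained critical pair $s\approx t\ [\varphi]$ of $\mathcal{R}$ is almost development closed, then for every substitution $\sigma$ with $\sigma\vDash\varphi$ we have $s\sigma\xrightarrow{\circ}\cdot\,{}^*\!\!\leftarrow t\sigma$, i.e. there is a term $w$ with $s\sigma\xrightarrow{\circ}w$ and $t\sigma\to^*w$.
   Context: Logically constrained rewriting. Fix a many-sorted signature $\mathcal{F}=\mathcal{F}_{\mathrm{te}}\cup\mathcal{F}_{\mathrm{th}}$ (possibly infinite) and an infinite set $\mathcal{V}$ of sorted variables. For every sort $\iota$ of $\mathcal{F}_{\mathrm{th}}$ there is a non-empty set $\mathcal{V}\mathrm{al}_\iota\subseteq\mathcal{F}_{\mathrm{th}}$ of constants of sort $\iota$ (values); $\mathcal{V}\mathrm{al}=\bigcup_\iota\mathcal{V}\mathrm{al}_\iota$, $\mathcal{F}_{\mathrm{te}}\cap\mathcal{F}_{\mathrm{th}}\subseteq\mathcal{V}\mathrm{al}$. Logical terms are terms of $\mathcal{T}(\mathcal{F}_{\mathrm{th}},\mathcal{V})$; a fixed interpretation $\mathcal{J}$ evaluates ground logical terms to values via $[\![f(t_1,\dots,t_n)]\!]=f_{\mathcal{J}}([\![t_1]\!],\dots,[\![t_n]\!])$. Constraints are logical terms of sort $\mathsf{bool}$ (with connectives, $\Rightarrow$, equality $=$). $\varphi$ is valid if $[\![\varphi\gamma]\!]=\top$ for all $\gamma$ mapping $\mathcal{V}\mathrm{ar}(\varphi)$ to values, satisfiable if this holds for some such $\gamma$; $\sigma\vDash\varphi$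 means $\sigma(x)\in\mathcal{V}\mathrm{al}$ for $x\in\mathcal{V}\mathrm{ar}(\varphi)$ and $\varphi\sigma$ valid. A constrained rewrite rule $\rho\colon\ell\to r\ [\varphi]$: $\ell,r$ terms of the same sort, $\mathrm{root}(\ell)\in\mathcal{F}_{\mathrm{te}}\setminus\mathcal{F}_{\mathrm{th}}$, $\varphi$ a constraint; $\mathcal{LV}\mathrm{ar}(\rho)=\mathcal{V}\mathrm{ar}(\varphi)\cup(\mathcal{V}\mathrm{ar}(r)\setminus\mathcal{V}\mathrm{ar}(\ell))$, $\mathcal{EV}\mathrm{ar}(\rho)=\mathcal{V}\mathrm{ar}(r)\setminus(\mathcal{V}\mathrm{ar}(\ell)\cup\mathcal{V}\mathrm{ar}(\varphi))$, $\mathcal{EC}_\rho=\bigwedge\{x=x\mid x\in\mathcal{EV}\mathrm{ar}(\rho)\}$. An LCTRS $\mathcal{R}$ is a set of such rules. $\sigma\vDash\rho$ means $\mathcal{D}\mathrm{om}(\sigma)=\mathcal{V}\mathrm{ar}(\ell)\cup\mathcal{V}\mathrm{ar}(r)\cup\mathcal{V}\mathrm{ar}(\varphi)$, $\sigma(x)\in\mathcal{V}\mathrm{al}$ for $x\in\mathcal{LV}\mathrm{ar}(\rho)$, $\varphi\sigma$ valid. Calculation rules: $f(x_1,\dots,x_n)\to y\ [y=f(x_1,\dots,x_n)]$ for $f\in\mathcal{F}_{\mathrm{th}}\setminus\mathcal{V}\mathrm{al}$, $y$ fresh; $\mathcal{R}_{\mathrm{rc}}$ is $\mathcal{R}$ together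 with them. Rewriting on terms: $s\to t$ if $s|_p=\ell\sigma$, $t=s[r\sigma]_p$ for $\rho\in\mathcal{R}_{\mathrm{rc}}$ and $\sigma\vDash\rho$. Multi-steps on terms: $x\xrightarrow{\circ}x$; $f(\vec s)\xrightarrow{\circ}f(\vec t)$ if $s_i\xrightarrow{\circ}t_i$ for all $i$; $\ell\sigma\xrightarrow{\circ}r\tau$ if $\rho\colon\ell\to r\ [\varphi]\in\mathcal{R}_{\mathrm{rc}}$, $\sigma\vDash\rho$, $\sigma(x)\xrightarrow{\circ}\tau(x)$ for all $x\in\mathcal{D}\mathrm{om}(\sigma)$. Constrained terms: pairs $s\ [\varphi]$. $s\ [\varphi]\sim t\ [\psi]$ iff for every $\gamma\vDash\varphi$ with $\mathcal{D}\mathrm{om}(\gamma)=\mathcal{V}\mathrm{ar}(\varphi)$ there is $\delta\vDash\psi$ with $\mathcal{D}\mathrm{om}(\delta)=\mathcal{V}\mathrm{ar}(\psi)$ and $s\gamma=t\delta$, and vice versa. $s\ [\varphi]\to s[r\sigma]_p\ [\varphi]$ if $s|_p=\ell\sigma$ for $\rho\colon\ell\to r\ [\psi]\in\mathcal{R}_{\mathrm{rc}}$ with $\sigma(x)\in\mathcal{V}\mathrm{al}\cup\mathcal{V}\mathrm{ar}(\varphi)$ for $x\in\mathcal{LV}\mathrm{ar}(\rho)$, $\varphi$ satisfiable, $\varphi\Rightarrow\psi\sigma$ valid; $\xrightarrow{\sim}={\sim}\cdot\to\cdot{\sim}$, $\xrightarrow{\sim}_{\geq q}$ requires the step at a position $\geq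 q$. Multi-steps on constrained terms: $x\ [\varphi]\xrightarrow{\circ}x\ [\varphi]$; $f(\vec s)\ [\varphi]\xrightarrow{\circ}f(\vec t)\ [\varphi]$ if $s_i\ [\varphi]\xrightarrow{\circ}t_i\ [\varphi]$; $\ell\sigma\ [\varphi]\xrightarrow{\circ}r\tau\ [\varphi]$ if $\rho\colon\ell\to r\ [\psi]\in\mathcal{R}_{\mathrm{rc}}$, $\sigma(x)\in\mathcal{V}\mathrm{al}\cup\mathcal{V}\mathrm{ar}(\varphi)$ for $x\in\mathcal{LV}\mathrm{ar}(\rho)$, $\varphi$ satisfiable, $\varphi\Rightarrow\psi\sigma$ valid, $\sigma(x)\ [\varphi]\xrightarrow{\circ}\tau(x)\ [\varphi]$ for all $x\in\mathcal{D}\mathrm{om}(\sigma)$; $\xrightarrow{\sim\circ}={\sim}\cdot\xrightarrow{\circ}\cdot{\sim}$, $\xrightarrow{\sim\circ}_{\geq q}$ requires all contracted redexes at positions $\geq q$. An equation $s\approx t$ is the term $\approx(s,t)$ for a fresh binary non-theory symbol (position $1q$/$2q$ = position $q$ in $s$/$t$). $u\approx v\ [\psi]$ is trivial if $u\sigma=v\sigma$ for all $\sigma\vDash\psi$. Constrained critical pairs: for variable-disjoint variants $\rho_i\colon\ell_i\to r_i\ [\varphi_i]$ of rules in $\mathcal{R}_{\mathrm{rc}}$, non-variable position $p$ of $\ell_2$, mgu $\sigma$ of $\ell_1,\ell_2|_p$ with $\sigma(x)\in\mathcal{V}\mathrm{al}\cup\mathcal{V}$ for all $x\in\mathcal{LV}\mathrm{ar}(\rho_1)\cup\mathcal{LV}\mathrm{ar}(\rho_2)$,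 $\varphi_1\sigma\wedge\varphi_2\sigma$ satisfiable, and (if $p=\epsilon$) $\rho_1,\rho_2$ not variants or $\mathcal{V}\mathrm{ar}(r_1)\not\subseteq\mathcal{V}\mathrm{ar}(\ell_1)$: the pair $\ell_2\sigma[r_1\sigma]_p\approx r_2\sigma\ [(\varphi_1\wedge\varphi_2\wedge\mathcal{EC}_{\rho_1}\wedge\mathcal{EC}_{\rho_2})\sigma]$, an overlay if $p=\epsilon$. It is almost development closed if either it is not an overlay and $s\approx t\ [\varphi]\xrightarrow{\sim\circ}_{\geq1}u\approx v\ [\psi]$ for some trivial $u\approx v\ [\psi]$, or it is an overlay and $s\approx t\ [\varphi]\xrightarrow{\sim\circ}_{\geq1}\cdot\xrightarrow{\sim}{}^*_{\geq2}u\approx v\ [\psi]$ for some trivial $u\approx v\ [\psi]$. -}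

module Defs where

open import Data.Nat using (ℕ; zero; suc)
open import Data.List using (List; []; _∷_; _++_; map; foldr; filter; deduplicate)
open import Data.List.Relation.Unary.All using (All)
open import Data.List.Relation.Unary.Unique.Propositional using (Unique)
open import Data.List.Relation.Binary.Pointwise using (Pointwise)
open import Data.List.Membership.Propositional using (_∈_; _∉_)
open import Data.Product using (Σ; ∃; ∃-syntax; Σ-syntax; _×_; _,_)
open import Data.Sum using (_⊎_)
open import Relation.Nullary using (¬_; ¬?)
open import Relation.Binary.PropositionalEquality using (_≡_; _≢_)
open import Relation.Binary.Definitions using (DecidableEquality)
open import Relation.Binary.Construct.Closure.ReflexiveTransitive using (Star)

record Signature : Set₁ where
  field
    Sort  : Set
    Sym   : Set
    arity : Sym → List Sort
    res   : Sym → Sort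
    IsTe  : Sym → Set
    IsTh  : Sym → Set
    IsVal : Sym → Set
    te∪th      : ∀ f → IsTe f ⊎ IsTh f
    val⊆th     : ∀ {f} → IsVal f → IsTh f
    val-const  : ∀ {f} → IsVal f → arity f ≡ []
    te∩th⊆val  : ∀ {f} → IsTe f → IsTh f → IsVal f
    ThSort       : Sort → Set
    th-arity     : ∀ {f} → IsTh f → All ThSort (arity f)
    th-res       : ∀ {f} → IsTh f → ThSort (res f)
    val-nonempty : ∀ {ι} → ThSort ι → ∃[ v ] (IsVal v × res v ≡ ι)
    Var          : Set
    vsort        : Var → Sort
    _≟V_         : DecidableEquality Var
    var-infinite : ∀ ι (xs : List Var) → ∃[ x ] (vsort x ≡ ι × x ∉ xs)
    -- interpretation J (on values; only used on well-sorted theory terms)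
    interp        : Sym → List Sym → Sym
    interp-val    : ∀ {v} → IsVal v → interp v [] ≡ v
    interp-closed : ∀ {f vs} → IsTh f →
                    Pointwise (λ v ι → IsVal v × res v ≡ ι) vs (arity f) →
                    IsVal (interp f vs) × res (interp f vs) ≡ res f
    bool    : Sort
    top     : Sym
    and imp : Sym
    eqS     : Sort → Sym
    top-val  : IsVal top
    top-sort : res top ≡ bool
    and-th   : IsTh and
    and-ar   : arity and ≡ bool ∷ bool ∷ []
    and-res  : res and ≡ bool
    imp-th   : IsTh imp
    imp-ar   : arity imp ≡ bool ∷ bool ∷ []
    imp-res  : res imp ≡ bool
    eq-th    : ∀ {ι} → ThSort ι → IsTh (eqS ι)
    eq-ar    : ∀ {ι} → ThSort ι → arity (eqS ι) ≡ ι ∷ ι ∷ []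
    eq-res   : ∀ {ι} → ThSort ι → res (eqS ι) ≡ bool
    and-sem  : ∀ {a b} → IsVal a → res a ≡ bool → IsVal b → res b ≡ bool →
               (interp and (a ∷ b ∷ []) ≡ top → a ≡ top × b ≡ top) ×
               (a ≡ top × b ≡ top → interp and (a ∷ b ∷ []) ≡ top)
    imp-sem  : ∀ {a b} → IsVal a → res a ≡ bool → IsVal b → res b ≡ bool →
               (interp imp (a ∷ b ∷ []) ≡ top → a ≡ top → b ≡ top) ×
               ((a ≡ top → b ≡ top) → interp imp (a ∷ b ∷ []) ≡ top)
    eq-sem   : ∀ {ι a b} → ThSort ι → IsVal a → res a ≡ ι → IsVal b → res b ≡ ι →
               (interp (eqS ι) (a ∷ b ∷ []) ≡ top → a ≡ b) ×
               (a ≡ b → interp (eqS ι) (a ∷ b ∷ []) ≡ top)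
    -- the fresh binary non-theory symbol ≈ used to form equations
    ≈sym    : Sym
    ≈-nonth : ¬ IsTh ≈sym

module LC (S : Signature) where
  open Signature S public
  open import Data.List.Membership.DecPropositional _≟V_ using (_∈?_)

  data Term : Set where
    var : Var → Term
    fun : Sym → List Term → Term

  Subst : Set
  Subst = Var → Term

  infixl 8 _·_ _·*_
  mutual
    _·_ : Term → Subst → Term
    var x · σ = σ x
    fun f ts · σ = fun f (ts ·* σ)

    _·*_ : List Term → Subst → List Term
    [] ·* σ = []
    (t ∷ ts) ·* σ = t · σ ∷ ts ·* σ

  data HasSort : Term → Sort → Set where
    var : ∀ {x} → HasSort (var x) (vsort x)
    fun : ∀ {f ts} → Pointwise HasSort ts (arity f) → HasSort (fun f ts) (res f)

  Sorted : Subst → Set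
  Sorted σ = ∀ x → HasSort (σ x) (vsort x)

  data Logical : Term → Set where
    var : ∀ {x} → Logical (var x)
    fun : ∀ {f ts} → IsTh f → All Logical ts → Logical (fun f ts)

  data _∈V_ (x : Var) : Term → Set where
    here  : x ∈V var x
    there : ∀ {f ts t} → t ∈ ts → x ∈V t → x ∈V fun f ts

  data Occurs (g : Sym) : Term → Set where
    here  : ∀ {ts} → Occurs g (fun g ts)
    there : ∀ {f ts t} → t ∈ ts → Occurs g t → Occurs g (fun f ts)

  mutual
    vars : Term → List Var
    vars (var x) = x ∷ []
    vars (fun f ts) = varsL ts

    varsL : List Term → List Var
    varsL [] = []
    varsL (t ∷ ts) = vars t ++ varsL ts

  IsValT : Term → Set
  IsValT t = ∃[ v ] (IsVal v × t ≡ fun v [])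

  data Eval : Term → Sym → Set where
    ev : ∀ {f ts vs} → IsTh f → Pointwise Eval ts vs → Eval (fun f ts) (interp f vs)

  ⊤t : Term
  ⊤t = fun top []

  infixr 6 _∧'_
  infixr 5 _⇒'_
  _∧'_ _⇒'_ : Term → Term → Term
  a ∧' b = fun and (a ∷ b ∷ [])
  a ⇒' b = fun imp (a ∷ b ∷ [])

  _==[_]_ : Term → Sort → Term → Term
  a ==[ ι ] b = fun (eqS ι) (a ∷ b ∷ [])

  ValuesOn : Term → Subst → Set
  ValuesOn φ γ = ∀ x → x ∈V φ → IsValT (γ x)

  Valid : Term → Set
  Valid φ = ∀ γ → Sorted γ → ValuesOn φ γ → Eval (φ · γ) top

  Satisfiable : Term → Set
  Satisfiable φ = ∃[ γ ] (Sorted γ × ValuesOn φ γ × Eval (φ · γ) top)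

  _⊨_ : Subst → Term → Set
  σ ⊨ φ = ValuesOn φ σ × Valid (φ · σ)

  record Rule : Set where
    constructor rule
    field
      lhs rhs con : Term
  open Rule public

  LVar : Rule → Var → Set
  LVar ρ x = x ∈V con ρ ⊎ (x ∈V rhs ρ × ¬ x ∈V lhs ρ)

  DomR : Rule → Var → Set
  DomR ρ x = x ∈V lhs ρ ⊎ x ∈V rhs ρ ⊎ x ∈V con ρ

  -- EVar(ρ) as a list (without duplicates)
  evars : Rule → List Var
  evars ρ = deduplicate _≟V_
    (filter (λ x → ¬? (x ∈? (vars (lhs ρ) ++ vars (con ρ)))) (vars (rhs ρ)))

  EC : Rule → Term
  EC ρ = foldr (λ x c → (var x ==[ vsort x ] var x) ∧' c) ⊤t (evars ρ)

  WFRule : Rule → Set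
  WFRule (rule ℓ r φ) =
    (∃[ ι ] (HasSort ℓ ι × HasSort r ι)) ×
    (∃[ f ] ∃[ ts ] (ℓ ≡ fun f ts × IsTe f × ¬ IsTh f)) ×
    Logical φ × HasSort φ bool

  record LCTRS : Set₁ where
    field
      rules   : Rule → Set
      wf      : ∀ {ρ} → rules ρ → WFRule ρ
      ≈-fresh : ∀ {ρ} → rules ρ →
                ¬ Occurs ≈sym (lhs ρ) × ¬ Occurs ≈sym (rhs ρ) × ¬ Occurs ≈sym (con ρ)

  data CalcRule : Rule → Set where
    calc : ∀ {f xs y} → IsTh f → ¬ IsVal f → Unique xs → map vsort xs ≡ arity f →
           vsort y ≡ res f → y ∉ xs →
           CalcRule (rule (fun f (map var xs)) (var y)
                          (var y ==[ res f ] fun f (map var xs)))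

  Rrc : (Rule → Set) → Rule → Set
  Rrc R ρ = R ρ ⊎ CalcRule ρ

  _⊨R_ : Subst → Rule → Set
  σ ⊨R ρ = Sorted σ × (∀ x → ¬ DomR ρ x → σ x ≡ var x) ×
           (∀ x → LVar ρ x → IsValT (σ x)) × Valid (con ρ · σ)

  -- positions (argument indices are 1-based), s|p and s[v]p

  Pos : Set
  Pos = List ℕ

  -- Repl p s u t v :  s|p = u  and  t = s[v]p
  mutual
    data Repl : Pos → Term → Term → Term → Term → Set where
      here : ∀ {u v} → Repl [] u u v v
      arg  : ∀ {i p f ss ts u v} → ReplL i p ss u ts v →
             Repl (i ∷ p) (fun f ss) u (fun f ts) v

    data ReplL : ℕ → Pos → List Term → Term → List Term → Term → Set where
      hd : ∀ {p s ss u t v} → Repl p s u t v → ReplL 1 p (s ∷ ss) u (t ∷ ss) v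
      tl : ∀ {i p s ss u ts v} → ReplL i p ss u ts v →
           ReplL (suc i) p (s ∷ ss) u (s ∷ ts) v

  -- q ≤ p  (p is below or equal to q)
  _≤P_ : Pos → Pos → Set
  q ≤P p = ∃[ r ] (p ≡ q ++ r)

  Step : (Rule → Set) → Term → Term → Set
  Step R s t = ∃[ ρ ] ∃[ p ] ∃[ σ ]
    (Rrc R ρ × σ ⊨R ρ × Repl p s (lhs ρ · σ) t (rhs ρ · σ))

  data MStep (R : Rule → Set) : Term → Term → Set where
    mvar  : ∀ {x} → MStep R (var x) (var x)
    mfun  : ∀ {f ss ts} → Pointwise (MStep R) ss ts → MStep R (fun f ss) (fun f ts)
    mrule : ∀ {ρ σ τ s t} → Rrc R ρ → σ ⊨R ρ →
            (∀ x → DomR ρ x → MStep R (σ x) (τ x)) →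
            s ≡ lhs ρ · σ → t ≡ rhs ρ · τ → MStep R s t

  CTerm : Set
  CTerm = Term × Term

  Inst : Term → Subst → Set
  Inst φ γ = Sorted γ × γ ⊨ φ × (∀ x → ¬ x ∈V φ → γ x ≡ var x)

  _~_ : CTerm → CTerm → Set
  (s , φ) ~ (t , ψ) =
    (∀ γ → Inst φ γ → ∃[ δ ] (Inst ψ δ × s · γ ≡ t · δ)) ×
    (∀ δ → Inst ψ δ → ∃[ γ ] (Inst φ γ × s · γ ≡ t · δ))

  CAdm : (Rule → Set) → Term → Rule → Subst → Set
  CAdm R φ ρ σ = Rrc R ρ × Sorted σ ×
    (∀ x → LVar ρ x → IsValT (σ x) ⊎ ∃[ y ] (σ x ≡ var y × y ∈V φ)) ×
    Satisfiable φ × Valid (φ ⇒' con ρ · σ)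

  CStepAt : (Rule → Set) → Pos → CTerm → CTerm → Set
  CStepAt R p (s , φ) (t , ψ) = ψ ≡ φ ×
    ∃[ ρ ] ∃[ σ ] (CAdm R φ ρ σ × Repl p s (lhs ρ · σ) t (rhs ρ · σ))

  CStep~≥ : (Rule → Set) → Pos → CTerm → CTerm → Set
  CStep~≥ R q a b = ∃[ a' ] ∃[ b' ] ∃[ p ]
    (a ~ a' × q ≤P p × CStepAt R p a' b' × b' ~ b)

  data CMStep (R : Rule → Set) (φ : Term) : Term → Term → Set where
    cvar  : ∀ {x} → CMStep R φ (var x) (var x)
    cfun  : ∀ {f ss ts} → Pointwise (CMStep R φ) ss ts →
            CMStep R φ (fun f ss) (fun f ts)
    crule : ∀ {ρ σ τ s t} → CAdm R φ ρ σ →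
            (∀ x → DomR ρ x → CMStep R φ (σ x) (τ x)) →
            s ≡ lhs ρ · σ → t ≡ rhs ρ · τ → CMStep R φ s t

  -- multi-step all of whose contracted redexes are at positions ≥ q:
  -- either nothing is contracted, or it is the identity outside s|q
  CMStep≥ : (Rule → Set) → Term → Pos → Term → Term → Set
  CMStep≥ R φ q s t = s ≡ t ⊎ ∃[ u ] ∃[ v ] (Repl q s u t v × CMStep R φ u v)

  CMStep~≥ : (Rule → Set) → Pos → CTerm → CTerm → Set
  CMStep~≥ R q a b = ∃[ s' ] ∃[ t' ] ∃[ φ' ]
    (a ~ (s' , φ') × CMStep≥ R φ' q s' t' × (t' , φ') ~ b)

  _≈ₑ_ : Term → Term → Term
  s ≈ₑ t = fun ≈sym (s ∷ t ∷ [])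

  Trivial : Term → Term → Term → Set
  Trivial u v ψ = ∀ σ → Sorted σ → σ ⊨ ψ → u · σ ≡ v · σ

  Renaming : (Var → Var) → Set
  Renaming π = (∀ x → vsort (π x) ≡ vsort x) ×
    Σ[ π⁻ ∈ (Var → Var) ] ((∀ x → π⁻ (π x) ≡ x) × (∀ x → π (π⁻ x) ≡ x))

  Variant : Rule → Rule → Set
  Variant ρ' ρ = ∃[ π ] (Renaming π ×
    ρ' ≡ rule (lhs ρ · (λ x → var (π x))) (rhs ρ · (λ x → var (π x)))
              (con ρ · (λ x → var (π x))))

  Unifies : Subst → Term → Term → Set
  Unifies σ a b = a · σ ≡ b · σ

  MGU : Subst → Term → Term → Set
  MGU σ a b = Sorted σ × Unifies σ a b ×
    (∀ θ → Sorted θ → Unifies θ a b → ∃[ δ ] (Sorted δ × (∀ x → θ x ≡ σ x · δ)))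

  NonVar : Term → Set
  NonVar t = ∃[ f ] ∃[ ts ] (t ≡ fun f ts)

  -- CP R p s t φ :  s ≈ t [φ] is a constrained critical pair of R
  -- obtained at position p (an overlay iff p = []).
  data CP (R : Rule → Set) : Pos → Term → Term → Term → Set where
    cp : ∀ {ρ₁₀ ρ₂₀ ρ₁ ρ₂ p u σ s t φ} →
         Rrc R ρ₁₀ → Rrc R ρ₂₀ → Variant ρ₁ ρ₁₀ → Variant ρ₂ ρ₂₀ →
         (∀ x → DomR ρ₁ x → ¬ DomR ρ₂ x) →
         Repl p (lhs ρ₂) u (lhs ρ₂) u → NonVar u →
         MGU σ (lhs ρ₁) u →
         (∀ x → LVar ρ₁ x ⊎ LVar ρ₂ x → IsValT (σ x) ⊎ ∃[ y ] (σ x ≡ var y)) →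
         Satisfiable (con ρ₁ · σ ∧' con ρ₂ · σ) →
         (p ≡ [] → ¬ Variant ρ₁ ρ₂ ⊎ ¬ (∀ x → x ∈V rhs ρ₁ → x ∈V lhs ρ₁)) →
         Repl p (lhs ρ₂ · σ) (u · σ) s (rhs ρ₁ · σ) →
         t ≡ rhs ρ₂ · σ →
         φ ≡ (con ρ₁ ∧' con ρ₂ ∧' EC ρ₁ ∧' EC ρ₂) · σ →
         CP R p s t φ

  ADC : (Rule → Set) → Pos → Term → Term → Term → Set
  ADC R p s t φ =
    (p ≢ [] × ∃[ u ] ∃[ v ] ∃[ ψ ]
       (CMStep~≥ R (1 ∷ []) (s ≈ₑ t , φ) (u ≈ₑ v , ψ) × Trivial u v ψ))
    ⊎
    (p ≡ [] × ∃[ u ] ∃[ v ] ∃[ ψ ] Σ[ m ∈ CTerm ]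
       (CMStep~≥ R (1 ∷ []) (s ≈ₑ t , φ) m ×
        Star (CStep~≥ R (2 ∷ [])) m (u ≈ₑ v , ψ) × Trivial u v ψ))

-- Every constrained (multi-)step u [ψ] → v [ψ] instantiates, under a solution θ of ψ, to
-- an ordinary (multi-)step u θ → v θ: validity of ψ ⇒ χ makes θ a solution of the rule
-- constraint χ. Equivalence ~ only re-parametrises the instances of a constrained term, so
-- the σ-instances of the equations along the closing sequence are linked by such steps.
-- The first part gives s σ ⇉ X leaving t σ alone, the second rewrites only the right-hand
-- side, t σ →* Z, and triviality of the final equation forces X = Z.
module Submission where

open import Defs
open import Data.Product using (∃-syntax; _×_; _,_; proj₁; proj₂)
open import Data.Sum using (_⊎_; inj₁; inj₂; [_,_]′)
open import Data.List using ([]; _∷_; map)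
open import Data.List.Relation.Unary.Any using (Any; here; there)
open import Data.List.Membership.Propositional using (_∈_; find; lose)
open import Data.List.Relation.Binary.Pointwise using (Pointwise; []; _∷_)
open import Data.Empty using (⊥-elim)
open import Relation.Nullary using (Dec; yes; no; ¬_)
open import Relation.Nullary.Decidable using (map′; _⊎-dec_)
open import Relation.Unary using (Decidable)
open import Relation.Binary.PropositionalEquality
open import Relation.Binary.Construct.Closure.ReflexiveTransitive using (Star; ε; _◅_)

module Substitutions (S : Signature) where
  open LC S

  infixl 9 _⨾_
  _⨾_ : Subst → Subst → Subst
  (σ ⨾ θ) x = σ x · θ

  mutual
    ·-⨾ : ∀ t σ θ → t · σ · θ ≡ t · (σ ⨾ θ)
    ·-⨾ (var x) σ θ = refl
    ·-⨾ (fun f ts) σ θ = cong (fun f) (·*-⨾ ts σ θ)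

    ·*-⨾ : ∀ ts σ θ → ts ·* σ ·* θ ≡ ts ·* (σ ⨾ θ)
    ·*-⨾ [] σ θ = refl
    ·*-⨾ (t ∷ ts) σ θ = cong₂ _∷_ (·-⨾ t σ θ) (·*-⨾ ts σ θ)

  mutual
    ·-cong-on : ∀ t {σ θ} → (∀ x → x ∈V t → σ x ≡ θ x) → t · σ ≡ t · θ
    ·-cong-on (var x) h = h x here
    ·-cong-on (fun f ts) h = cong (fun f) (·*-cong-on ts (λ m x p → h x (there m p)))

    ·*-cong-on : ∀ ts {σ θ} → (∀ {t} → t ∈ ts → ∀ x → x ∈V t → σ x ≡ θ x) →
                 ts ·* σ ≡ ts ·* θ
    ·*-cong-on [] h = refl
    ·*-cong-on (t ∷ ts) h =
      cong₂ _∷_ (·-cong-on t (h (here refl))) (·*-cong-on ts (λ m → h (there m)))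

  mutual
    ∈V-·⁻ : ∀ t σ {x} → x ∈V (t · σ) → ∃[ y ] (y ∈V t × x ∈V σ y)
    ∈V-·⁻ (var y) σ p = y , here , p
    ∈V-·⁻ (fun f ts) σ (there m p) =
      let y , (_ , u∈ , y∈u) , x∈ = ∈V-·*⁻ ts σ m p in y , there u∈ y∈u , x∈

    ∈V-·*⁻ : ∀ ts σ {x u} → u ∈ ts ·* σ → x ∈V u →
             ∃[ y ] ((∃[ t ] (t ∈ ts × y ∈V t)) × x ∈V σ y)
    ∈V-·*⁻ (t ∷ ts) σ (here refl) p =
      let y , y∈ , x∈ = ∈V-·⁻ t σ p in y , (t , here refl , y∈) , x∈
    ∈V-·*⁻ (t ∷ ts) σ (there m) p =
      let y , (u , u∈ , y∈) , x∈ = ∈V-·*⁻ ts σ m p in y , (u , there u∈ , y∈) , x∈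

  mutual
    _∈V?_ : ∀ x t → Dec (x ∈V t)
    x ∈V? var y = map′ (λ { refl → here }) (λ { here → refl }) (x ≟V y)
    x ∈V? fun f ts = map′ (λ a → let _ , m , p = find a in there m p)
                          (λ { (there m p) → lose m p }) (x ∈V*? ts)

    _∈V*?_ : ∀ x ts → Dec (Any (x ∈V_) ts)
    x ∈V*? [] = no λ ()
    x ∈V*? (t ∷ ts) = map′ [ here , there ]′ (λ { (here p) → inj₁ p ; (there a) → inj₂ a })
                           ((x ∈V? t) ⊎-dec (x ∈V*? ts))

  value-· : ∀ {t} θ → IsValT t → t · θ ≡ t
  value-· θ (v , _ , refl) = refl

  value-∉V : ∀ {t x} → IsValT t → ¬ x ∈V t
  value-∉V (v , _ , refl) (there () _)

  mutual
    HasSort-· : ∀ {t ι θ} → Sorted θ → HasSort t ι → HasSort (t · θ) ι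
    HasSort-· {var x} sθ var = sθ x
    HasSort-· sθ (fun hs) = fun (HasSort-·* sθ hs)

    HasSort-·* : ∀ {ts ιs θ} → Sorted θ → Pointwise HasSort ts ιs →
                 Pointwise HasSort (ts ·* θ) ιs
    HasSort-·* sθ [] = []
    HasSort-·* sθ (h ∷ hs) = HasSort-· sθ h ∷ HasSort-·* sθ hs

  Sorted-⨾ : ∀ {σ θ} → Sorted σ → Sorted θ → Sorted (σ ⨾ θ)
  Sorted-⨾ sσ sθ x = HasSort-· sθ (sσ x)

  mutual
    Repl-· : ∀ {p s u t v} θ → Repl p s u t v → Repl p (s · θ) (u · θ) (t · θ) (v · θ)
    Repl-· θ here = here
    Repl-· θ (arg r) = arg (ReplL-· θ r)

    ReplL-· : ∀ {i p ss u ts v} θ → ReplL i p ss u ts v →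
              ReplL i p (ss ·* θ) (u · θ) (ts ·* θ) (v · θ)
    ReplL-· θ (hd r) = hd (Repl-· θ r)
    ReplL-· θ (tl r) = tl (ReplL-· θ r)

  ≈ₑ-injective : ∀ {a b c d} → a ≈ₑ b ≡ c ≈ₑ d → a ≡ c × b ≡ d
  ≈ₑ-injective refl = refl , refl

  module _ {P : Var → Set} (P? : Decidable P) where

    restrict : Subst → Subst
    restrict σ x with P? x
    ... | yes _ = σ x
    ... | no _ = var x

    restrict-∈ : ∀ σ {x} → P x → restrict σ x ≡ σ x
    restrict-∈ σ {x} px with P? x
    ... | yes _ = refl
    ... | no ¬px = ⊥-elim (¬px px)

    restrict-∉ : ∀ σ {x} → ¬ P x → restrict σ x ≡ var x
    restrict-∉ σ {x} ¬px with P? x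
    ... | yes px = ⊥-elim (¬px px)
    ... | no _ = refl

    Sorted-restrict : ∀ {σ} → Sorted σ → Sorted (restrict σ)
    Sorted-restrict {σ} sσ x with P? x
    ... | yes _ = sσ x
    ... | no _ = var

    ·-restrict : ∀ t σ → (∀ x → x ∈V t → P x) → t · restrict σ ≡ t · σ
    ·-restrict t σ h = ·-cong-on t (λ x p → restrict-∈ σ (h x p))

  mutual
    Eval-deterministic : ∀ {t v w} → Eval t v → Eval t w → v ≡ w
    Eval-deterministic (ev _ p) (ev _ q) = cong (interp _) (Eval*-deterministic p q)

    Eval*-deterministic : ∀ {ts vs ws} → Pointwise Eval ts vs → Pointwise Eval ts ws → vs ≡ ws
    Eval*-deterministic [] [] = refl
    Eval*-deterministic (p ∷ ps) (q ∷ qs) =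
      cong₂ _∷_ (Eval-deterministic p q) (Eval*-deterministic ps qs)

  mutual
    Eval-sort : ∀ {t v ι} → Eval t v → HasSort t ι → IsVal v × res v ≡ ι
    Eval-sort (ev th p) (fun hs) = interp-closed th (Eval*-sort p hs)

    Eval*-sort : ∀ {ts vs ιs} → Pointwise Eval ts vs → Pointwise HasSort ts ιs →
                 Pointwise (λ v ι → IsVal v × res v ≡ ι) vs ιs
    Eval*-sort [] [] = []
    Eval*-sort (p ∷ ps) (h ∷ hs) = Eval-sort p h ∷ Eval*-sort ps hs

  ⇒-elim : ∀ {a b} → Eval (a ⇒' b) top → Eval a top → HasSort b bool → Eval b top
  ⇒-elim a⇒b⇓ a⇓top b∶bool = elim a⇒b⇓ refl
    where
      elim : ∀ {w} → Eval (_ ⇒' _) w → w ≡ top → Eval _ top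
      elim (ev _ (a⇓ ∷ b⇓ ∷ [])) imp≡top with refl ← Eval-deterministic a⇓ a⇓top =
        let b-val , b-bool = Eval-sort b⇓ b∶bool
        in subst (Eval _) (proj₁ (imp-sem top-val top-sort b-val b-bool) imp≡top refl) b⇓

  ⊨-Eval : ∀ {φ θ} → θ ⊨ φ → Eval (φ · θ) top
  ⊨-Eval {φ} {θ} (vals , valid) =
    subst (λ u → Eval u top) ground (valid var (λ x → var) (λ x p → ⊥-elim (no-vars p)))
    where
      ground : φ · θ · var ≡ φ · θ
      ground = trans (·-⨾ φ θ var) (·-cong-on φ (λ x p → value-· var (vals x p)))
      no-vars : ∀ {x} → ¬ x ∈V (φ · θ)
      no-vars p = let y , y∈ , x∈ = ∈V-·⁻ φ _ p in value-∉V (vals y y∈) x∈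

  Inst-⨾ : ∀ {φ δ σ} → Inst φ δ → Sorted σ → Sorted (δ ⨾ σ) × (δ ⨾ σ) ⊨ φ
  Inst-⨾ {φ} {σ = σ} (sδ , (vals , valid) , _) sσ =
    Sorted-⨾ sδ sσ ,
    (λ x p → subst IsValT (sym (value-· σ (vals x p))) (vals x p)) ,
    subst Valid (sym (·-cong-on φ (λ x p → value-· σ (vals x p)))) valid

  -- u = s (δ ⨾ σ) for an instance δ of c = s [φ]: σ closes the variables outside Var(φ).
  record Covers (σ : Subst) (c : CTerm) (u : Term) : Set where
    constructor covers
    field
      valuation : Subst
      is-inst   : Inst (proj₂ c) valuation
      closes    : proj₁ c · (valuation ⨾ σ) ≡ u

  Covers-~ : ∀ {σ a b u} → a ~ b → Covers σ a u → Covers σ b u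
  Covers-~ {σ} {s , _} {t , _} (a→b , _) (covers δ iδ refl) =
    let δ' , iδ' , eq = a→b δ iδ in
    covers δ' iδ' (trans (sym (·-⨾ t δ' σ)) (trans (cong (_· σ) (sym eq)) (·-⨾ s δ σ)))

  ⊨-Covers : ∀ {σ φ} s → Sorted σ → σ ⊨ φ → Covers σ (s , φ) (s · σ)
  ⊨-Covers {σ} {φ} s sσ (vals , valid) = covers
    (restrict (_∈V? φ) σ)
    (Sorted-restrict (_∈V? φ) sσ ,
     ((λ x p → subst IsValT (sym (restrict-∈ (_∈V? φ) σ p)) (vals x p)) ,
      subst Valid (sym (·-restrict (_∈V? φ) φ σ (λ _ p → p))) valid) ,
     λ x → restrict-∉ (_∈V? φ) σ)
    (·-cong-on s (λ x _ → restrict-⨾ x))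
    where
      restrict-⨾ : ∀ x → restrict (_∈V? φ) σ x · σ ≡ σ x
      restrict-⨾ x with x ∈V? φ
      ... | yes p = value-· σ (vals x p)
      ... | no _ = refl

  Covers-Trivial : ∀ {σ u v ψ X Z} → Sorted σ → Trivial u v ψ →
                   Covers σ (u ≈ₑ v , ψ) (X ≈ₑ Z) → X ≡ Z
  Covers-Trivial {σ} sσ trivial (covers δ iδ eq) =
    let eqX , eqZ = ≈ₑ-injective eq
        sθ , θ⊨ψ = Inst-⨾ iδ sσ
    in trans (sym eqX) (trans (trivial (δ ⨾ σ) sθ θ⊨ψ) eqZ)

module Instantiation (S : Signature) (R : LC.Rule S → Set)
                     (wf : ∀ {ρ} → R ρ → LC.WFRule S ρ) where
  open LC S
  open Substitutions S

  CalcRule-con-sort : ∀ {ρ} → CalcRule ρ → HasSort (con ρ) bool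
  CalcRule-con-sort (calc {xs = xs} {y = y} th _ _ xs-sorts y-sort _) =
    subst (HasSort _) (eq-res (th-res th))
      (fun (subst (Pointwise HasSort _) (sym (eq-ar (th-res th)))
        (subst (HasSort (var y)) y-sort var ∷
         fun (subst (Pointwise HasSort (map var xs)) xs-sorts (vars-sorts xs)) ∷ [])))
    where
      vars-sorts : ∀ xs → Pointwise HasSort (map var xs) (map vsort xs)
      vars-sorts [] = []
      vars-sorts (x ∷ xs) = var ∷ vars-sorts xs

  con-sort : ∀ {ρ} → Rrc R ρ → HasSort (con ρ) bool
  con-sort (inj₁ r) = proj₂ (proj₂ (proj₂ (wf r)))
  con-sort (inj₂ c) = CalcRule-con-sort c

  DomR? : ∀ ρ → Decidable (DomR ρ)
  DomR? ρ x = (x ∈V? lhs ρ) ⊎-dec (x ∈V? rhs ρ) ⊎-dec (x ∈V? con ρ)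

  module _ {φ ρ σ θ} (adm : CAdm R φ ρ σ) (sθ : Sorted θ) (θ⊨φ : θ ⊨ φ) where

    CAdm-LVar-value : ∀ x → LVar ρ x → IsValT (σ x · θ)
    CAdm-LVar-value x l with proj₁ (proj₂ (proj₂ adm)) x l
    ... | inj₁ v = subst IsValT (sym (value-· θ v)) v
    ... | inj₂ (y , eq , y∈φ) rewrite eq = proj₁ θ⊨φ y y∈φ

    -- Modus ponens: θ closes φ ⇒ con ρ · σ, as the variables of con ρ · σ are values or
    -- variables of φ.
    CAdm-con-Eval : Eval (con ρ · σ · θ) top
    CAdm-con-Eval =
      ⇒-elim (valid θ sθ values) (⊨-Eval θ⊨φ) (HasSort-· sθ (HasSort-· sσ (con-sort ρ∈R)))
      where
        ρ∈R = proj₁ adm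
        sσ = proj₁ (proj₂ adm)
        lvars = proj₁ (proj₂ (proj₂ adm))
        valid = proj₂ (proj₂ (proj₂ (proj₂ adm)))
        values : ValuesOn (φ ⇒' con ρ · σ) θ
        values x (there (here refl) p) = proj₁ θ⊨φ x p
        values x (there (there (here refl)) p) with ∈V-·⁻ (con ρ) σ p
        ... | y , y∈ , x∈ with lvars y (inj₁ y∈)
        ...   | inj₁ v = ⊥-elim (value-∉V v x∈)
        ...   | inj₂ (z , eq , z∈φ) with here ← subst (x ∈V_) eq x∈ = proj₁ θ⊨φ z z∈φ

    CAdm-⊨R : restrict (DomR? ρ) (σ ⨾ θ) ⊨R ρ
    CAdm-⊨R =
      Sorted-restrict (DomR? ρ) (Sorted-⨾ (proj₁ (proj₂ adm)) sθ) ,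
      (λ x → restrict-∉ (DomR? ρ) _) ,
      lvar-values ,
      λ γ _ _ → subst (λ w → Eval w top) (sym (con-ground γ)) CAdm-con-Eval
      where
        lvar-values : ∀ x → LVar ρ x → IsValT (restrict (DomR? ρ) (σ ⨾ θ) x)
        lvar-values x l@(inj₁ p) rewrite restrict-∈ (DomR? ρ) (σ ⨾ θ) (inj₂ (inj₂ p)) =
          CAdm-LVar-value x l
        lvar-values x l@(inj₂ (p , _)) rewrite restrict-∈ (DomR? ρ) (σ ⨾ θ) (inj₂ (inj₁ p)) =
          CAdm-LVar-value x l
        con-ground : ∀ γ → con ρ · restrict (DomR? ρ) (σ ⨾ θ) · γ ≡ con ρ · σ · θ
        con-ground γ = begin
          con ρ · restrict (DomR? ρ) (σ ⨾ θ) · γ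
            ≡⟨ cong (_· γ) (·-restrict (DomR? ρ) (con ρ) _ (λ _ p → inj₂ (inj₂ p))) ⟩
          con ρ · (σ ⨾ θ) · γ
            ≡⟨ ·-⨾ (con ρ) _ γ ⟩
          con ρ · (σ ⨾ θ ⨾ γ)
            ≡⟨ ·-cong-on (con ρ) (λ x p → value-· γ (CAdm-LVar-value x (inj₁ p))) ⟩
          con ρ · (σ ⨾ θ)
            ≡⟨ ·-⨾ (con ρ) σ θ ⟨
          con ρ · σ · θ
            ∎
          where open ≡-Reasoning

  lhs-⨾-restrict : ∀ ρ σ θ → lhs ρ · σ · θ ≡ lhs ρ · restrict (DomR? ρ) (σ ⨾ θ)
  lhs-⨾-restrict ρ σ θ =
    trans (·-⨾ (lhs ρ) σ θ) (sym (·-restrict (DomR? ρ) (lhs ρ) _ (λ _ p → inj₁ p)))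

  rhs-⨾-restrict : ∀ ρ σ θ → rhs ρ · σ · θ ≡ rhs ρ · restrict (DomR? ρ) (σ ⨾ θ)
  rhs-⨾-restrict ρ σ θ =
    trans (·-⨾ (rhs ρ) σ θ) (sym (·-restrict (DomR? ρ) (rhs ρ) _ (λ _ p → inj₂ (inj₁ p))))

  mutual
    MStep-refl : ∀ t → MStep R t t
    MStep-refl (var x) = mvar
    MStep-refl (fun f ts) = mfun (MStep*-refl ts)

    MStep*-refl : ∀ ts → Pointwise (MStep R) ts ts
    MStep*-refl [] = []
    MStep*-refl (t ∷ ts) = MStep-refl t ∷ MStep*-refl ts

  mutual
    CMStep-instance : ∀ {φ θ a b} → Sorted θ → θ ⊨ φ → CMStep R φ a b → MStep R (a · θ) (b · θ)
    CMStep-instance sθ θ⊨φ cvar = MStep-refl _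
    CMStep-instance sθ θ⊨φ (cfun steps) = mfun (CMStep*-instance sθ θ⊨φ steps)
    CMStep-instance {θ = θ} sθ θ⊨φ (crule {ρ} {σ} {τ} adm args refl refl) =
      mrule (proj₁ adm) (CAdm-⊨R adm sθ θ⊨φ)
        (λ x d → subst₂ (MStep R) (sym (restrict-∈ (DomR? ρ) _ d)) (sym (restrict-∈ (DomR? ρ) _ d))
                   (CMStep-instance sθ θ⊨φ (args x d)))
        (lhs-⨾-restrict ρ σ θ) (rhs-⨾-restrict ρ τ θ)

    CMStep*-instance : ∀ {φ θ as bs} → Sorted θ → θ ⊨ φ → Pointwise (CMStep R φ) as bs →
                       Pointwise (MStep R) (as ·* θ) (bs ·* θ)
    CMStep*-instance sθ θ⊨φ [] = []
    CMStep*-instance sθ θ⊨φ (p ∷ ps) = CMStep-instance sθ θ⊨φ p ∷ CMStep*-instance sθ θ⊨φ ps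

  StepAt : Pos → Term → Term → Set
  StepAt p s t = ∃[ ρ ] ∃[ σ ] (Rrc R ρ × σ ⊨R ρ × Repl p s (lhs ρ · σ) t (rhs ρ · σ))

  CStepAt-instance : ∀ {p a b φ ψ θ} → Sorted θ → θ ⊨ φ →
                     CStepAt R p (a , φ) (b , ψ) → StepAt p (a · θ) (b · θ)
  CStepAt-instance {p} {a} {b} {θ = θ} sθ θ⊨φ (refl , ρ , σ , adm , r) =
    ρ , restrict (DomR? ρ) (σ ⨾ θ) , proj₁ adm , CAdm-⊨R adm sθ θ⊨φ ,
    subst₂ (λ u v → Repl p (a · θ) u (b · θ) v)
      (lhs-⨾-restrict ρ σ θ) (rhs-⨾-restrict ρ σ θ) (Repl-· θ r)

  StepAt-≈ʳ : ∀ {r Y Z w} → StepAt (2 ∷ r) (Y ≈ₑ Z) w → ∃[ Z' ] (w ≡ Y ≈ₑ Z' × Step R Z Z')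
  StepAt-≈ʳ (ρ , σ , ρ∈R , σ⊨ρ , arg (tl (hd r))) = _ , refl , ρ , _ , σ , ρ∈R , σ⊨ρ , r

  CStep~≥-≈ʳ-instance : ∀ {σ a b Y Z} → Sorted σ → CStep~≥ R (2 ∷ []) a b →
                        Covers σ a (Y ≈ₑ Z) → ∃[ Z' ] (Step R Z Z' × Covers σ b (Y ≈ₑ Z'))
  CStep~≥-≈ʳ-instance sσ ((a' , φ') , (b' , _) , _ , a~a' , (_ , refl) , step@(refl , _) , b'~b) cov
    with covers δ iδ a'δσ ← Covers-~ {b = a' , φ'} a~a' cov =
    let sθ , θ⊨φ = Inst-⨾ iδ sσ
        Z' , eq , Z→Z' = StepAt-≈ʳ (subst (λ u → StepAt _ u _) a'δσ (CStepAt-instance sθ θ⊨φ step))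
    in Z' , Z→Z' , Covers-~ {a = b' , φ'} b'~b (covers δ iδ eq)

  Star-CStep~≥-≈ʳ-instance : ∀ {σ a b Y Z} → Sorted σ → Star (CStep~≥ R (2 ∷ [])) a b →
                             Covers σ a (Y ≈ₑ Z) →
                             ∃[ Z' ] (Star (Step R) Z Z' × Covers σ b (Y ≈ₑ Z'))
  Star-CStep~≥-≈ʳ-instance sσ ε cov = _ , ε , cov
  Star-CStep~≥-≈ʳ-instance sσ (step ◅ steps) cov =
    let Z₁ , Z→Z₁ , cov₁ = CStep~≥-≈ʳ-instance sσ step cov
        Z' , Z₁→*Z' , cov' = Star-CStep~≥-≈ʳ-instance sσ steps cov₁
    in Z' , Z→Z₁ ◅ Z₁→*Z' , cov'

  MStepBelow : Pos → Term → Term → Set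
  MStepBelow q a b = a ≡ b ⊎ ∃[ u ] ∃[ v ] (Repl q a u b v × MStep R u v)

  CMStep≥-instance : ∀ {φ θ q a b} → Sorted θ → θ ⊨ φ → CMStep≥ R φ q a b →
                     MStepBelow q (a · θ) (b · θ)
  CMStep≥-instance sθ θ⊨φ (inj₁ refl) = inj₁ refl
  CMStep≥-instance {θ = θ} sθ θ⊨φ (inj₂ (u , v , r , u⇉v)) =
    inj₂ (u · θ , v · θ , Repl-· θ r , CMStep-instance sθ θ⊨φ u⇉v)

  MStepBelow-≈ˡ : ∀ {X Z w} → MStepBelow (1 ∷ []) (X ≈ₑ Z) w →
                  ∃[ X' ] (MStep R X X' × w ≡ X' ≈ₑ Z)
  MStepBelow-≈ˡ (inj₁ refl) = _ , MStep-refl _ , refl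
  MStepBelow-≈ˡ (inj₂ (_ , _ , arg (hd here) , u⇉v)) = _ , u⇉v , refl

  CMStep~≥-≈ˡ-instance : ∀ {σ a b X Z} → Sorted σ → CMStep~≥ R (1 ∷ []) a b →
                         Covers σ a (X ≈ₑ Z) → ∃[ X' ] (MStep R X X' × Covers σ b (X' ≈ₑ Z))
  CMStep~≥-≈ˡ-instance sσ (a' , b' , φ' , a~a' , steps , b'~b) cov
    with covers δ iδ a'δσ ← Covers-~ {b = a' , φ'} a~a' cov =
    let sθ , θ⊨φ = Inst-⨾ iδ sσ
        X' , X⇉X' , eq = MStepBelow-≈ˡ (subst (λ u → MStepBelow _ u _) a'δσ
                                          (CMStep≥-instance sθ θ⊨φ steps))
    in X' , X⇉X' , Covers-~ {a = b' , φ'} b'~b (covers δ iδ eq)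

  ADC-joinable : ∀ {p s t φ σ} → Sorted σ → σ ⊨ φ → ADC R p s t φ →
                 ∃[ w ] (MStep R (s · σ) w × Star (Step R) (t · σ) w)
  ADC-joinable {s = s} {t} sσ σ⊨φ (inj₁ (_ , u , v , _ , left , trivial))
    with X , s⇉X , cov ← CMStep~≥-≈ˡ-instance sσ left (⊨-Covers (s ≈ₑ t) sσ σ⊨φ) =
    X , s⇉X , subst (Star (Step R) _) (sym (Covers-Trivial {u = u} {v} sσ trivial cov)) ε
  ADC-joinable {s = s} {t} sσ σ⊨φ (inj₂ (_ , u , v , _ , _ , left , right , trivial))
    with X , s⇉X , cov ← CMStep~≥-≈ˡ-instance sσ left (⊨-Covers (s ≈ₑ t) sσ σ⊨φ)
    with Z , t→*Z , cov' ← Star-CStep~≥-≈ʳ-instance sσ right cov =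
    X , s⇉X , subst (Star (Step R) _) (sym (Covers-Trivial {u = u} {v} sσ trivial cov')) t→*Z

-- Being a critical pair is irrelevant: every almost development closed equation is joinable.
lemma4 : (S : Signature) (ℛ : LC.LCTRS S) →
    let open LC S in
    let R = LCTRS.rules ℛ in
    ∀ p s t φ → CP R p s t φ → ADC R p s t φ →
    ∀ σ → Sorted σ → σ ⊨ φ →
    ∃[ w ] (MStep R (s · σ) w × Star (Step R) (t · σ) w)
lemma4 S ℛ p s t φ _ adc σ sσ σ⊨φ =
  Instantiation.ADC-joinable S (LC.LCTRS.rules ℛ) (LC.LCTRS.wf ℛ) {p} {s} {t} sσ σ⊨φ adc
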